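{- Let $a,b$ be positive integers such that either $a=b\ge2$ and $a$ is even, or $a>b\ge2$. Define $(g_{a,b}(n))_{n\in\mathbb{N}}$ by $g_{a,b}(n)=0$ for integers $n<0$, $g_{a,b}(0)=a$, $g_{a,b}(1)=b$, and $g_{a,b}(n)=g_{a,b}(n-g_{a,b}(n-1))+g_{a,b}(n-2)$ for $n>1$. Then for all $n\in\mathbb{N}$, $$g_{a,b}(2n+1)=b,\qquad g_{a,b}(2n+2)=g_{a,b}(2n+2-b)+g_{a,b}(2n).$$ In particular, $$g_{a,b}(2n)=\begin{cases}a&\text{if }n<\lfloor b/2\rfloor,\\ a+(n-\lfloor b/2\rfloor)b&\text{if }b\text{ is odd and }n\ge\lfloor b/2\rfloor,\\ 2^na&\text{if }b=2.\end{cases}$$ -}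

module Defs where

open import Data.Nat using (ℕ; zero; suc; _+_; _∸_; _≤?_)
open import Data.Integer using (ℤ; +_; -[1+_])
open import Relation.Nullary using (yes; no)

-- One step of the recurrence g(m) = g(m - g(m-1)) + g(m-2), for m ≥ 1,
-- given the already computed values f k = g(k) for k < m.
-- g(m - p) is read as 0 when m - p < 0 (i.e. p > m).
-- If g(m-1) = 0 the paper's recurrence would be circular/undefined; we
-- return the default 0 in that case (never reached under the theorem's
-- hypotheses, where all values are ≥ 2).
step : ℕ → ℕ → (ℕ → ℕ) → ℕ
step b zero f = 0
step b (suc zero) f = b
step b (suc (suc m')) f with f (suc m')
... | zero = 0
... | suc q with suc q ≤? suc (suc m')
...   | yes _ = f (suc (suc m') ∸ suc q) + f m'
...   | no  _ = 0 + f m'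

-- table a b n k = g_{a,b}(k) for k ≤ n.
table : ℕ → ℕ → ℕ → ℕ → ℕ
table a b zero zero = a
table a b zero (suc k) = 0
table a b (suc n) k with k ≤? n
... | yes _ = table a b n k
... | no  _ = step b (suc n) (table a b n)

g : ℕ → ℕ → ℕ → ℕ
g a b n = table a b n n

gℤ : ℕ → ℕ → ℤ → ℕ
gℤ a b (+ n) = g a b n
gℤ a b -[1+ n ] = 0

{-# OPTIONS --safe #-}
module Submission where

-- By strong induction on j: g(2j+1) = b, g(2j) ≥ a and g(2j) > 2j+1. The last bound makes
-- the back-reference of g(2j+3) = g(2j+3 - g(2j+2)) + g(2j+1) land before index 0, so odd
-- terms stay b and the even terms obey g(2n+2) = g(2n+2-b) + g(2n). If 2n+2 < b this is
-- g(2n) ≥ a, and the hypothesis on a, b gives a ≥ 2n+4; otherwise it exceeds g(2n) by a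
-- value ≥ 2. Unrolling the even recurrence gives the closed forms: for odd b the term
-- g(2n+2-b) sits at an odd index and equals b, and for b = 2 it equals g(2n).

open import Defs
open import Data.Nat using (ℕ; zero; suc; z≤n; s≤s; _+_; _*_; _∸_; _^_; _%_; _/_; _≤_; _<_; _≤?_)
open import Data.Nat.Properties
open import Data.Nat.DivMod using (m≡m%n+[m/n]*n; m%n<n; m/n*n≤m)
open import Data.Nat.Divisibility using (_∣_; divides; m%n≡0⇒n∣m)
open import Data.Nat.Induction using (<-rec)
open import Data.Integer using (+_; _-_)
import Data.Integer.Properties as ℤ
open import Data.Product using (_×_; _,_; proj₁; proj₂; ∃-syntax)
open import Data.Sum using (_⊎_; inj₁; inj₂)
open import Relation.Nullary using (¬_; yes; no; contradiction)
open import Relation.Binary.PropositionalEquality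
  using (_≡_; refl; sym; trans; cong; cong₂; subst; module ≡-Reasoning)

step-≤ : ∀ b m f {p} → f (suc m) ≡ suc p → suc p ≤ suc (suc m) →
         step b (suc (suc m)) f ≡ f (suc (suc m) ∸ suc p) + f m
step-≤ b m f {p} eq p≤ with f (suc m) | eq
... | _ | refl with suc p ≤? suc (suc m)
...   | yes _  = refl
...   | no p≰ = contradiction p≤ p≰

step-> : ∀ b m f {p} → f (suc m) ≡ suc p → suc (suc m) < suc p →
         step b (suc (suc m)) f ≡ f m
step-> b m f {p} eq p> with f (suc m) | eq
... | _ | refl with suc p ≤? suc (suc m)
...   | yes p≤ = contradiction p≤ (<⇒≱ p>)
...   | no _   = refl

g-suc : ∀ a b n → g a b (suc n) ≡ step b (suc n) (table a b n)
g-suc a b n with suc n ≤? n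
... | yes n<n = contradiction n<n (<-irrefl refl)
... | no _    = refl

table-≤ : ∀ a b {n k} → k ≤ n → table a b n k ≡ g a b k
table-≤ a b {zero} z≤n = refl
table-≤ a b {suc n} {k} k≤1+n with k ≤? n
... | yes k≤n = table-≤ a b k≤n
... | no k≰n  = trans (sym (g-suc a b n)) (cong (g a b) (≤-antisym (≰⇒> k≰n) k≤1+n))

g-rec-≤ : ∀ a b m {p} → 0 < p → g a b (suc m) ≡ p → p ≤ suc (suc m) →
          g a b (suc (suc m)) ≡ g a b (suc (suc m) ∸ p) + g a b m
g-rec-≤ a b m {suc p} _ eq p≤ = begin
  g a b (suc (suc m))
    ≡⟨ g-suc a b (suc m) ⟩
  step b (suc (suc m)) (table a b (suc m))
    ≡⟨ step-≤ b m (table a b (suc m)) eq p≤ ⟩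
  table a b (suc m) (suc m ∸ p) + table a b (suc m) m
    ≡⟨ cong₂ _+_ (table-≤ a b (m∸n≤m (suc m) p)) (table-≤ a b (n≤1+n m)) ⟩
  g a b (suc m ∸ p) + g a b m
    ∎
  where open ≡-Reasoning

g-rec-> : ∀ a b m {p} → g a b (suc m) ≡ p → suc (suc m) < p →
          g a b (suc (suc m)) ≡ g a b m
g-rec-> a b m {suc p} eq p> = begin
  g a b (suc (suc m))                       ≡⟨ g-suc a b (suc m) ⟩
  step b (suc (suc m)) (table a b (suc m))  ≡⟨ step-> b m (table a b (suc m)) eq p> ⟩
  table a b (suc m) m                       ≡⟨ table-≤ a b (n≤1+n m) ⟩
  g a b m                                   ∎
  where open ≡-Reasoning

gℤ-≥ : ∀ a b {m p} → p ≤ m → gℤ a b (+ m - + p) ≡ g a b (m ∸ p)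
gℤ-≥ a b {m} {p} p≤m rewrite ℤ.m-n≡m⊖n m p | ℤ.⊖-≥ p≤m = refl

gℤ-< : ∀ a b {m p} → m < p → gℤ a b (+ m - + p) ≡ 0
gℤ-< a b {m} {p} m<p rewrite ℤ.m-n≡m⊖n m p | ℤ.⊖-< m<p with p ∸ m | m<n⇒0<n∸m m<p
... | suc _ | _ = refl

g-rec : ∀ a b m {p} → 0 < p → g a b (suc m) ≡ p →
        g a b (suc (suc m)) ≡ gℤ a b (+ suc (suc m) - + p) + g a b m
g-rec a b m {p} 0<p eq with p ≤? suc (suc m)
... | yes p≤ = trans (g-rec-≤ a b m 0<p eq p≤) (cong (_+ g a b m) (sym (gℤ-≥ a b p≤)))
... | no p≰  = trans (g-rec-> a b m eq (≰⇒> p≰)) (cong (_+ g a b m) (sym (gℤ-< a b (≰⇒> p≰))))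

even-or-odd : ∀ k → ∃[ i ] (k ≡ i * 2 ⊎ k ≡ suc (i * 2))
even-or-odd zero = 0 , inj₁ refl
even-or-odd (suc k) with even-or-odd k
... | i , inj₁ refl = i , inj₂ refl
... | i , inj₂ refl = suc i , inj₁ refl

odd≡1+[m/2]*2 : ∀ {m} → ¬ 2 ∣ m → m ≡ suc (m / 2 * 2)
odd≡1+[m/2]*2 {m} 2∤m with m % 2 | m≡m%n+[m/n]*n m 2 | m%n<n m 2 | m%n≡0⇒n∣m m 2
... | 0           | _  | _             | 2∣m = contradiction (2∣m refl) 2∤m
... | 1           | eq | _             | _   = eq
... | suc (suc _) | _  | s≤s (s≤s ()) | _

Admissible : ℕ → ℕ → Set
Admissible a b = (a ≡ b × 2 ≤ a × 2 ∣ a) ⊎ (b < a × 2 ≤ b)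

admissible⇒2≤b : ∀ {a b} → Admissible a b → 2 ≤ b
admissible⇒2≤b (inj₁ (refl , 2≤a , _)) = 2≤a
admissible⇒2≤b (inj₂ (_ , 2≤b))        = 2≤b

admissible⇒b≤a : ∀ {a b} → Admissible a b → b ≤ a
admissible⇒b≤a (inj₁ (refl , _ , _)) = ≤-refl
admissible⇒b≤a (inj₂ (b<a , _))      = <⇒≤ b<a

-- For a = b this is where evenness is needed: an odd a would fail at i * 2 = a - 1.
admissible⇒[1+i]*2≤a : ∀ {a b} → Admissible a b → ∀ i → i * 2 < b → suc i * 2 ≤ a
admissible⇒[1+i]*2≤a (inj₁ (refl , _ , divides k refl)) i i*2<b =
  *-monoˡ-≤ 2 (*-cancelʳ-< 2 i k i*2<b)
admissible⇒[1+i]*2≤a (inj₂ (b<a , _)) i i*2<b = ≤-trans (s≤s i*2<b) b<a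

-- Even indices are written i * 2 rather than 2 * i so that suc i * 2 reduces to 2 + i * 2.
module Sequence {a b : ℕ} (admissible : Admissible a b) where

  G : ℕ → ℕ
  G = g a b

  2≤b : 2 ≤ b
  2≤b = admissible⇒2≤b admissible

  2≤a : 2 ≤ a
  2≤a = ≤-trans 2≤b (admissible⇒b≤a admissible)

  0<b : 0 < b
  0<b = ≤-trans (s≤s z≤n) 2≤b

  record Shape (e : ℕ) : Set where
    field
      g[1+e]≡b : G (suc e) ≡ b
      a≤g[e]   : a ≤ G e
      1+e<g[e] : suc e < G e
  open Shape

  rec-≤ : ∀ {e} → Shape e → b ≤ 2 + e → G (2 + e) ≡ G (2 + e ∸ b) + G e
  rec-≤ {e} sh = g-rec-≤ a b e 0<b (g[1+e]≡b sh)

  rec-> : ∀ {e} → Shape e → 2 + e < b → G (2 + e) ≡ G e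
  rec-> {e} sh = g-rec-> a b e (g[1+e]≡b sh)

  2≤g[k] : ∀ {j} → (∀ {i} → i < j → Shape (i * 2)) → ∀ {k} → k < j * 2 → 2 ≤ G k
  2≤g[k] below {k} k<j*2 with even-or-odd k
  ... | i , inj₁ refl = ≤-trans 2≤a (a≤g[e] (below (*-cancelʳ-< 2 i _ k<j*2)))
  ... | i , inj₂ refl =
    subst (2 ≤_) (sym (g[1+e]≡b (below (*-cancelʳ-< 2 i _ (<-trans (n<1+n _) k<j*2))))) 2≤b

  g[2+e]-bounds : ∀ {n} → (∀ {i} → i < suc n → Shape (i * 2)) →
                  a ≤ G (2 + n * 2) × 3 + n * 2 < G (2 + n * 2)
  g[2+e]-bounds {n} below with b ≤? 2 + n * 2
  ... | yes b≤ rewrite rec-≤ (below ≤-refl) b≤ =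
          ≤-trans (a≤g[e] (below ≤-refl)) (m≤n+m _ _)
        , +-mono-≤ (2≤g[k] below (∸-monoʳ-< 0<b b≤)) (1+e<g[e] (below ≤-refl))
  ... | no b≰ rewrite rec-> (below ≤-refl) (≰⇒> b≰) =
          a≤g[e] (below ≤-refl)
        , ≤-trans (admissible⇒[1+i]*2≤a admissible (suc n) (≰⇒> b≰)) (a≤g[e] (below ≤-refl))

  shape : ∀ j → Shape (j * 2)
  shape = <-rec (λ j → Shape (j * 2)) shape-from-below
    where
    shape-from-below : ∀ j → (∀ {i} → i < j → Shape (i * 2)) → Shape (j * 2)
    shape-from-below zero _ = record { g[1+e]≡b = refl ; a≤g[e] = ≤-refl ; 1+e<g[e] = 2≤a }
    shape-from-below (suc n) below = record
      { g[1+e]≡b = trans (g-rec-> a b (suc (n * 2)) refl (proj₂ bounds)) (g[1+e]≡b (below ≤-refl))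
      ; a≤g[e]   = proj₁ bounds
      ; 1+e<g[e] = proj₂ bounds
      }
      where bounds = g[2+e]-bounds below

  g[n*2]≡a : ∀ n → n * 2 < b → G (n * 2) ≡ a
  g[n*2]≡a zero    _  = refl
  g[n*2]≡a (suc n) lt = trans (rec-> (shape n) lt) (g[n*2]≡a n (≤-trans (m≤n+m _ 2) lt))

  g[[d+k]*2]≡d*b+a : ∀ {k} → b ≡ suc (k * 2) → ∀ d → G ((d + k) * 2) ≡ d * b + a
  g[[d+k]*2]≡d*b+a {k} b≡ zero    = g[n*2]≡a k (≤-reflexive (sym b≡))
  g[[d+k]*2]≡d*b+a {k} b≡ (suc d) = begin
    G (2 + (d + k) * 2)                        ≡⟨ rec-≤ (shape (d + k)) b≤ ⟩
    G (2 + (d + k) * 2 ∸ b) + G ((d + k) * 2)  ≡⟨ cong₂ _+_ (cong G back) (g[[d+k]*2]≡d*b+a b≡ d) ⟩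
    G (suc (d * 2)) + (d * b + a)              ≡⟨ cong (_+ (d * b + a)) (g[1+e]≡b (shape d)) ⟩
    b + (d * b + a)                            ≡⟨ +-assoc b (d * b) a ⟨
    suc d * b + a                              ∎
    where
    open ≡-Reasoning
    b≤ : b ≤ 2 + (d + k) * 2
    b≤ = subst (_≤ 2 + (d + k) * 2) (sym b≡) (s≤s (m≤n⇒m≤1+n (*-monoˡ-≤ 2 (m≤n+m k d))))
    back : 2 + (d + k) * 2 ∸ b ≡ suc (d * 2)
    back = begin
      2 + (d + k) * 2 ∸ b            ≡⟨ cong (2 + (d + k) * 2 ∸_) b≡ ⟩
      suc ((d + k) * 2) ∸ k * 2      ≡⟨ cong (λ x → suc x ∸ k * 2) (*-distribʳ-+ 2 d k) ⟩
      suc (d * 2) + k * 2 ∸ k * 2    ≡⟨ m+n∸n≡m (suc (d * 2)) (k * 2) ⟩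
      suc (d * 2)                    ∎

  g[n*2]-odd-b : ∀ {n} → ¬ 2 ∣ b → b / 2 ≤ n → G (n * 2) ≡ (n ∸ b / 2) * b + a
  g[n*2]-odd-b {n} 2∤b b/2≤n = trans (cong (λ m → G (m * 2)) (sym (m∸n+n≡m b/2≤n)))
                                     (g[[d+k]*2]≡d*b+a (odd≡1+[m/2]*2 2∤b) (n ∸ b / 2))

  g[n*2]-b≡2 : b ≡ 2 → ∀ n → G (n * 2) ≡ 2 ^ n * a
  g[n*2]-b≡2 b≡2 zero    = sym (+-identityʳ a)
  g[n*2]-b≡2 b≡2 (suc n) = begin
    G (2 + n * 2)                  ≡⟨ rec-≤ (shape n) b≤ ⟩
    G (2 + n * 2 ∸ b) + G (n * 2)  ≡⟨ cong (λ c → G (2 + n * 2 ∸ c) + G (n * 2)) b≡2 ⟩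
    G (n * 2) + G (n * 2)          ≡⟨ cong (λ x → x + x) (g[n*2]-b≡2 b≡2 n) ⟩
    2 ^ n * a + 2 ^ n * a          ≡⟨ cong (λ x → 2 ^ n * a + x) (+-identityʳ _) ⟨
    2 * (2 ^ n * a)                ≡⟨ *-assoc 2 (2 ^ n) a ⟨
    2 ^ suc n * a                  ∎
    where
    open ≡-Reasoning
    b≤ : b ≤ 2 + n * 2
    b≤ = subst (_≤ 2 + n * 2) (sym b≡2) (s≤s (s≤s z≤n))

  g[2n+1]≡b : ∀ n → G (2 * n + 1) ≡ b
  g[2n+1]≡b n rewrite +-comm (2 * n) 1 | *-comm 2 n = g[1+e]≡b (shape n)

  g[2n+2]-rec : ∀ n → G (2 * n + 2) ≡ gℤ a b (+ (2 * n + 2) - + b) + G (2 * n)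
  g[2n+2]-rec n rewrite +-comm (2 * n) 2 | *-comm 2 n = g-rec a b (n * 2) 0<b (g[1+e]≡b (shape n))

theorem6p2 : (a b : ℕ) →
    ((a ≡ b × 2 ≤ a × 2 ∣ a) ⊎ (b < a × 2 ≤ b)) →
    (∀ n → g a b (2 * n + 1) ≡ b)
    × (∀ n → g a b (2 * n + 2) ≡ gℤ a b (+ (2 * n + 2) - + b) + g a b (2 * n))
    × (∀ n → n < b / 2 → g a b (2 * n) ≡ a)
    × (∀ n → ¬ (2 ∣ b) → b / 2 ≤ n → g a b (2 * n) ≡ a + (n ∸ b / 2) * b)
    × (b ≡ 2 → ∀ n → g a b (2 * n) ≡ 2 ^ n * a)
theorem6p2 a b admissible =
    g[2n+1]≡b
  , g[2n+2]-rec
  , (λ n n<b/2 → trans (cong G (*-comm 2 n))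
                       (g[n*2]≡a n (<-≤-trans (*-monoˡ-< 2 n<b/2) (m/n*n≤m b 2))))
  , (λ n 2∤b b/2≤n → trans (cong G (*-comm 2 n))
                           (trans (g[n*2]-odd-b 2∤b b/2≤n) (+-comm _ a)))
  , (λ b≡2 n → trans (cong G (*-comm 2 n)) (g[n*2]-b≡2 b≡2 n))
  where open Sequence admissible
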